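{- Let $\mathcal{C}$ be a finite set, $T$ a positive integer and $1-(1/T)\le p<1$. Consider a random sequence of nested subsets $\mathcal{C}\supseteq\mathcal{A}_0\supseteq\mathcal{A}_1\supseteq\cdots\supseteq\mathcal{A}_T$ obtained as follows: $\mathcal{A}_0$ includes each element of $\mathcal{C}$ independently with probability $1/2$; and for $i=0,\dots,T-1$, given $\mathcal{A}_i$, the set $\mathcal{A}_{i+1}$ is obtained by including each element of $\mathcal{A}_i$ independently with probability $p$. Then: (a) For integers $0\le i\le j\le T$ and any outcome of $\mathcal{A}_j$, conditional on this outcome, for each $x\in\mathcal{C}$ we have $x\in\mathcal{A}_i$ with probability at least $(j-i)\cdot(1-p)/6$. (b) For integers $0\le i<j\le T$ with $j-i+1\le T/2$ and any outcomes of $\mathcal{A}_i$ and $\mathcal{A}_j$, conditional on these outcomes, for each $x\in\mathcal{A}_i$ we have $x\in\mathcal{A}_{j-1}$ with probability at least $(T/(j-i))\cdot(1-p)/2$.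
   Context: Conditioning is on outcomes that occur with positive probability.
   Formalization: The parameter $p$ takes only rational values. -}

module Defs where

open import Data.Nat using (ℕ; zero; suc)
open import Data.Integer using (+_)
open import Data.Bool using (Bool; true; false; if_then_else_; _∧_)
open import Data.Fin using (Fin; zero; suc)
open import Data.Fin.Subset using (Subset)
open import Data.Vec using (Vec; []; _∷_; lookup)
open import Data.List using (List; []; _∷_; concatMap; map; foldr; filter)
open import Data.Rational using (ℚ; 0ℚ; 1ℚ; ½; _+_; _*_; _-_; _/_)

-- m /ℕ k : the rational number m/k (k = 0 gives 0, never used in the statement).
_/ℕ_ : ℕ → ℕ → ℚ
m /ℕ zero = 0ℚ
m /ℕ suc k = + m / suc k

_∈ᵇ_ : ∀ {n} → Fin n → Subset n → Bool
x ∈ᵇ A = lookup A x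

allSubsets : (n : ℕ) → List (Subset n)
allSubsets zero = [] ∷ []
allSubsets (suc n) = concatMap (λ s → (false ∷ s) ∷ (true ∷ s) ∷ []) (allSubsets n)

allVecs : ∀ {a} {A : Set a} → List A → (k : ℕ) → List (Vec A k)
allVecs xs zero = [] ∷ []
allVecs xs (suc k) = concatMap (λ x → map (x ∷_) (allVecs xs k)) xs

Outcome : ℕ → ℕ → Set
Outcome n T = Vec (Subset n) (suc T)

allOutcomes : (n T : ℕ) → List (Outcome n T)
allOutcomes n T = allVecs (allSubsets n) (suc T)

prodQ : List ℚ → ℚ
prodQ = foldr _*_ 1ℚ

_^ℚ_ : ℚ → ℕ → ℚ
q ^ℚ zero = 1ℚ
q ^ℚ suc k = q * (q ^ℚ k)

elemStep : ℚ → Bool → Bool → ℚ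
elemStep p true  true  = p
elemStep p true  false = 1ℚ - p
elemStep p false true  = 0ℚ
elemStep p false false = 1ℚ

stepProb : ∀ {n} → ℚ → Subset n → Subset n → ℚ
stepProb p [] [] = 1ℚ
stepProb p (a ∷ A) (b ∷ B) = elemStep p a b * stepProb p A B

chainProb : ∀ {n k} → ℚ → Subset n → Vec (Subset n) k → ℚ
chainProb p A [] = 1ℚ
chainProb p A (B ∷ Bs) = stepProb p A B * chainProb p B Bs

outcomeProb : ∀ {n T} → ℚ → Outcome n T → ℚ
outcomeProb {n} p (A₀ ∷ As) = (½ ^ℚ n) * chainProb p A₀ As

Pr : (n T : ℕ) → ℚ → (Outcome n T → Bool) → ℚ
Pr n T p E = foldr (λ ω acc → (if E ω then outcomeProb p ω else 0ℚ) + acc) 0ℚ (allOutcomes n T)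

open import Relation.Binary.Definitions using (DecidableEquality)
import Data.Vec.Properties as VP
import Data.Bool as B

_≟ˢ_ : ∀ {n} → DecidableEquality (Subset n)
_≟ˢ_ = VP.≡-dec B._≟_

-- The elements of C evolve independently, each along the chain "present, then removed at every step with
-- probability 1 - p", so conditioning on A_j (and A_i) conditions the trajectory of x only on its own
-- membership at those times. That trajectory is determined by the lifetime L of x, the number of times at
-- which x is present, and P(a < L ≤ b) = (p^a - p^b) / 2 for a ≤ b ≤ T. Both parts therefore reduce to
-- inequalities between powers of p under (1 - p) T ≤ 1: part (a) uses 1 - p^K ≥ K (1 - p) p^(K-1) and
-- p^k ≥ 1/3 for k < T, part (b) uses Bernoulli's inequality 1 - p^K ≤ K (1 - p) and p^(K-1) ≥ 1/2.

module Submission where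

open import Defs
open import Data.Nat using (ℕ; suc; _+_; _≤_; _<_; _∸_; _*_)
open import Data.Bool using (true; _∧_)
open import Data.Fin using (Fin; toℕ; pred)
open import Data.Fin.Subset using (Subset)
open import Data.Vec using (lookup)
open import Data.Product using (_×_)
open import Relation.Binary.PropositionalEquality using (_≡_)
open import Relation.Nullary.Decidable using (⌊_⌋)
open import Data.Rational using (ℚ; 0ℚ; 1ℚ) renaming (_≤_ to _≤ℚ_; _<_ to _<ℚ_; _*_ to _*ℚ_; _-_ to _-ℚ_)

open import Data.Nat using (zero; z≤n; s≤s; _<ᵇ_; _≤ᵇ_)
import Data.Nat.Properties as ℕ
open import Data.Integer using (+_)
import Data.Integer as ℤ
import Data.Integer.Properties as ℤ
open import Data.Bool using (Bool; false; not; if_then_else_)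
import Data.Bool as Bool
import Data.Bool.Properties as Bool
open import Data.Fin using (zero; suc)
import Data.Fin.Properties as Fin
open import Data.Vec using (Vec; []; _∷_; zipWith; tail)
import Data.Vec.Properties as Vec
open import Data.List using (List; []; _∷_; concatMap; map; foldr; _++_)
open import Data.Product using (_,_; map₂)
open import Data.Rational using (½) renaming (_+_ to _+ℚ_; _/_ to _/ℚ_)
import Data.Rational as ℚ
import Data.Rational.Properties as ℚ
import Data.Rational.Unnormalised as ℚᵘ
import Data.Rational.Unnormalised.Properties as ℚᵘ
open import Data.Rational.Solver using (module +-*-Solver)
open +-*-Solver using (solve; _:+_; _:-_; _:*_; _:=_; con)
open import Relation.Binary.PropositionalEquality using (refl; sym; trans; cong; cong₂; subst; module ≡-Reasoning)
open import Relation.Nullary.Decidable using (isYes≗does)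
open import Algebra.Bundles using (CommutativeMonoid)
open import Algebra.Properties.CommutativeSemigroup
  (CommutativeMonoid.commutativeSemigroup Bool.∧-commutativeMonoid) using (interchange; xy∙z≈xz∙y)

private variable
  A C : Set
  k n : ℕ

∑ : List A → (A → ℚ) → ℚ
∑ xs f = foldr (λ x s → f x +ℚ s) 0ℚ xs

infix 5 ∑
syntax ∑ xs (λ x → e) = ∑[ x ∈ xs ] e

∑-cong : (xs : List A) {f g : A → ℚ} → (∀ x → f x ≡ g x) → ∑ xs f ≡ ∑ xs g
∑-cong []       f≗g = refl
∑-cong (x ∷ xs) f≗g = cong₂ _+ℚ_ (f≗g x) (∑-cong xs f≗g)

∑-++ : (xs ys : List A) (f : A → ℚ) → ∑ (xs ++ ys) f ≡ ∑ xs f +ℚ ∑ ys f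
∑-++ []       ys f = sym (ℚ.+-identityˡ _)
∑-++ (x ∷ xs) ys f = trans (cong (f x +ℚ_) (∑-++ xs ys f)) (sym (ℚ.+-assoc (f x) _ _))

∑-concatMap : (g : A → List C) (xs : List A) (f : C → ℚ) →
  ∑ (concatMap g xs) f ≡ ∑[ x ∈ xs ] ∑ (g x) f
∑-concatMap g []       f = refl
∑-concatMap g (x ∷ xs) f =
  trans (∑-++ (g x) (concatMap g xs) f) (cong (∑ (g x) f +ℚ_) (∑-concatMap g xs f))

∑-map : (h : A → C) (xs : List A) (f : C → ℚ) → ∑ (map h xs) f ≡ ∑[ x ∈ xs ] f (h x)
∑-map h []       f = refl
∑-map h (x ∷ xs) f = cong (f (h x) +ℚ_) (∑-map h xs f)

∑-zero : (xs : List A) → ∑[ x ∈ xs ] 0ℚ ≡ 0ℚ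
∑-zero []       = refl
∑-zero (x ∷ xs) = trans (ℚ.+-identityˡ _) (∑-zero xs)

∑-+ : (xs : List A) (f g : A → ℚ) → ∑[ x ∈ xs ] (f x +ℚ g x) ≡ ∑ xs f +ℚ ∑ xs g
∑-+ []       f g = refl
∑-+ (x ∷ xs) f g = trans (cong ((f x +ℚ g x) +ℚ_) (∑-+ xs f g))
  (solve 4 (λ a b c d → (a :+ b) :+ (c :+ d) := (a :+ c) :+ (b :+ d)) refl (f x) (g x) (∑ xs f) (∑ xs g))

*-distribˡ-∑ : (a : ℚ) (xs : List A) (f : A → ℚ) → a *ℚ ∑ xs f ≡ ∑[ x ∈ xs ] a *ℚ f x
*-distribˡ-∑ a []       f = ℚ.*-zeroʳ a
*-distribˡ-∑ a (x ∷ xs) f = trans (ℚ.*-distribˡ-+ a (f x) _) (cong (a *ℚ f x +ℚ_) (*-distribˡ-∑ a xs f))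

*-distribʳ-∑ : (a : ℚ) (xs : List A) (f : A → ℚ) → ∑ xs f *ℚ a ≡ ∑[ x ∈ xs ] f x *ℚ a
*-distribʳ-∑ a []       f = ℚ.*-zeroˡ a
*-distribʳ-∑ a (x ∷ xs) f = trans (ℚ.*-distribʳ-+ a (f x) _) (cong (f x *ℚ a +ℚ_) (*-distribʳ-∑ a xs f))

∑-comm : (xs : List A) (ys : List C) (f : A → C → ℚ) →
  ∑[ x ∈ xs ] ∑ ys (f x) ≡ ∑[ y ∈ ys ] ∑[ x ∈ xs ] f x y
∑-comm []       ys f = sym (∑-zero ys)
∑-comm (x ∷ xs) ys f =
  trans (cong (∑ ys (f x) +ℚ_) (∑-comm xs ys f)) (sym (∑-+ ys (f x) (λ y → ∑[ x′ ∈ xs ] f x′ y)))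

nonneg-+ : ∀ {a b} → 0ℚ ≤ℚ a → 0ℚ ≤ℚ b → 0ℚ ≤ℚ a +ℚ b
nonneg-+ = ℚ.+-mono-≤

nonneg-* : ∀ {a b} → 0ℚ ≤ℚ a → 0ℚ ≤ℚ b → 0ℚ ≤ℚ a *ℚ b
nonneg-* {a} {b} 0≤a 0≤b =
  ℚ.nonNegative⁻¹ _ {{ℚ.nonNeg*nonNeg⇒nonNeg a {{ℚ.nonNegative 0≤a}} b {{ℚ.nonNegative 0≤b}}}}

∑-nonneg : (xs : List A) {f : A → ℚ} → (∀ x → 0ℚ ≤ℚ f x) → 0ℚ ≤ℚ ∑ xs f
∑-nonneg []       0≤f = ℚ.≤-refl
∑-nonneg (x ∷ xs) 0≤f = nonneg-+ (0≤f x) (∑-nonneg xs 0≤f)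

≤-by-gap : ∀ {a b} c → 0ℚ ≤ℚ c → b ≡ a +ℚ c → a ≤ℚ b
≤-by-gap {a} c 0≤c refl = ℚ.≤-trans (ℚ.≤-reflexive (sym (ℚ.+-identityʳ a))) (ℚ.+-monoʳ-≤ a 0≤c)

p≤q⇒0≤q-p : ∀ {a b} → a ≤ℚ b → 0ℚ ≤ℚ b -ℚ a
p≤q⇒0≤q-p {a} {b} a≤b = ℚ.≤-trans (ℚ.≤-reflexive (sym (ℚ.+-inverseʳ a))) (ℚ.+-monoˡ-≤ (ℚ.- a) a≤b)

*-monoˡ-≤-nonneg : ∀ {r a b} → 0ℚ ≤ℚ r → a ≤ℚ b → r *ℚ a ≤ℚ r *ℚ b
*-monoˡ-≤-nonneg {r} 0≤r = ℚ.*-monoˡ-≤-nonNeg r {{ℚ.nonNegative 0≤r}}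

*-monoʳ-≤-nonneg : ∀ {r a b} → 0ℚ ≤ℚ r → a ≤ℚ b → a *ℚ r ≤ℚ b *ℚ r
*-monoʳ-≤-nonneg {r} 0≤r = ℚ.*-monoʳ-≤-nonNeg r {{ℚ.nonNegative 0≤r}}

scale≤1 : ∀ {c P} → c ≤ℚ 1ℚ → 0ℚ ≤ℚ P → c *ℚ P ≤ℚ P
scale≤1 {P = P} c≤1 0≤P = ℚ.≤-trans (*-monoʳ-≤-nonneg 0≤P c≤1) (ℚ.≤-reflexive (ℚ.*-identityˡ P))

0≤1 : 0ℚ ≤ℚ 1ℚ
0≤1 = ℚ.*≤* (ℤ.+≤+ z≤n)

0≤½ : 0ℚ ≤ℚ ½
0≤½ = ℚ.*≤* (ℤ.+≤+ z≤n)

𝟙 : Bool → ℚ → ℚ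
𝟙 b x = if b then x else 0ℚ

𝟙-∧ : ∀ a b x y → 𝟙 (a ∧ b) (x *ℚ y) ≡ 𝟙 a x *ℚ 𝟙 b y
𝟙-∧ true  true  x y = refl
𝟙-∧ true  false x y = sym (ℚ.*-zeroʳ x)
𝟙-∧ false b     x y = sym (ℚ.*-zeroˡ (𝟙 b y))

𝟙-nonneg : ∀ b {x} → 0ℚ ≤ℚ x → 0ℚ ≤ℚ 𝟙 b x
𝟙-nonneg true  0≤x = 0≤x
𝟙-nonneg false 0≤x = ℚ.≤-refl

∑-𝟙-* : (xs : List A) (e : A → Bool) (a : ℚ) (f : A → ℚ) →
  ∑[ x ∈ xs ] 𝟙 (e x) (a *ℚ f x) ≡ a *ℚ (∑[ x ∈ xs ] 𝟙 (e x) (f x))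
∑-𝟙-* xs e a f = trans (∑-cong xs 𝟙-*) (sym (*-distribˡ-∑ a xs _))
  where
  𝟙-* : ∀ x → 𝟙 (e x) (a *ℚ f x) ≡ a *ℚ 𝟙 (e x) (f x)
  𝟙-* x with e x
  ... | true  = refl
  ... | false = sym (ℚ.*-zeroʳ a)

fromℕ : ℕ → ℚ
fromℕ n = + n /ℚ 1

fromℕ-+ : ∀ m n → fromℕ (m + n) ≡ fromℕ m +ℚ fromℕ n
fromℕ-+ m n = ℚ.toℚᵘ-injective (begin-equality
  ℚ.toℚᵘ (fromℕ (m + n))
    ≃⟨ ℚ.toℚᵘ-fromℚᵘ (ℚᵘ.mkℚᵘ (+ (m + n)) 0) ⟩
  ℚᵘ.mkℚᵘ (+ (m + n)) 0
    ≃⟨ ℚᵘ.*≡* eq ⟩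
  ℚᵘ.mkℚᵘ (+ m) 0 ℚᵘ.+ ℚᵘ.mkℚᵘ (+ n) 0
    ≃⟨ ℚᵘ.+-cong (ℚ.toℚᵘ-fromℚᵘ (ℚᵘ.mkℚᵘ (+ m) 0)) (ℚ.toℚᵘ-fromℚᵘ (ℚᵘ.mkℚᵘ (+ n) 0)) ⟨
  ℚ.toℚᵘ (fromℕ m) ℚᵘ.+ ℚ.toℚᵘ (fromℕ n)
    ≃⟨ ℚ.toℚᵘ-homo-+ (fromℕ m) (fromℕ n) ⟨
  ℚ.toℚᵘ (fromℕ m +ℚ fromℕ n) ∎)
  where
  open ℚᵘ.≤-Reasoning
  eq : + (m + n) ℤ.* + 1 ≡ ((+ m ℤ.* + 1) ℤ.+ (+ n ℤ.* + 1)) ℤ.* + 1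
  eq = cong (ℤ._* + 1) (trans (ℤ.pos-+ m n) (sym (cong₂ ℤ._+_ (ℤ.*-identityʳ (+ m)) (ℤ.*-identityʳ (+ n)))))

fromℕ-suc : ∀ n → fromℕ (suc n) ≡ 1ℚ +ℚ fromℕ n
fromℕ-suc = fromℕ-+ 1

fromℕ-nonneg : ∀ n → 0ℚ ≤ℚ fromℕ n
fromℕ-nonneg n = ℚ.nonNegative⁻¹ (fromℕ n) {{ℚ.normalize-nonNeg n 1}}

fromℕ-mono : ∀ {m n} → m ≤ n → fromℕ m ≤ℚ fromℕ n
fromℕ-mono {m} {n} m≤n = ≤-by-gap (fromℕ (n ∸ m)) (fromℕ-nonneg (n ∸ m))
  (trans (cong fromℕ (sym (ℕ.m+[n∸m]≡n m≤n))) (fromℕ-+ m (n ∸ m)))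

/ℕ-nonneg : ∀ m k → 0ℚ ≤ℚ m /ℕ k
/ℕ-nonneg m zero    = ℚ.≤-refl
/ℕ-nonneg m (suc k) = ℚ.nonNegative⁻¹ (m /ℕ suc k) {{ℚ.normalize-nonNeg m (suc k)}}

/ℕ*fromℕ : ∀ m k → 1 ≤ k → (m /ℕ k) *ℚ fromℕ k ≡ fromℕ m
/ℕ*fromℕ m (suc k) _ = ℚ.toℚᵘ-injective (begin-equality
  ℚ.toℚᵘ ((m /ℕ suc k) *ℚ fromℕ (suc k))
    ≃⟨ ℚ.toℚᵘ-homo-* (m /ℕ suc k) (fromℕ (suc k)) ⟩
  ℚ.toℚᵘ (m /ℕ suc k) ℚᵘ.* ℚ.toℚᵘ (fromℕ (suc k))
    ≃⟨ ℚᵘ.*-cong (ℚ.toℚᵘ-fromℚᵘ (ℚᵘ.mkℚᵘ (+ m) k)) (ℚ.toℚᵘ-fromℚᵘ (ℚᵘ.mkℚᵘ (+ suc k) 0)) ⟩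
  ℚᵘ.mkℚᵘ (+ m) k ℚᵘ.* ℚᵘ.mkℚᵘ (+ suc k) 0
    ≃⟨ ℚᵘ.*≡* eq ⟩
  ℚᵘ.mkℚᵘ (+ m) 0
    ≃⟨ ℚ.toℚᵘ-fromℚᵘ (ℚᵘ.mkℚᵘ (+ m) 0) ⟨
  ℚ.toℚᵘ (fromℕ m) ∎)
  where
  open ℚᵘ.≤-Reasoning
  eq : (+ m ℤ.* + suc k) ℤ.* + 1 ≡ + m ℤ.* + (suc k * 1)
  eq = trans (ℤ.*-identityʳ _) (cong ((+ m) ℤ.*_) (cong +_ (sym (ℕ.*-identityʳ (suc k)))))

^-+ : ∀ p a b → p ^ℚ (a + b) ≡ p ^ℚ a *ℚ p ^ℚ b
^-+ p zero    b = sym (ℚ.*-identityˡ _)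
^-+ p (suc a) b = trans (cong (p *ℚ_) (^-+ p a b)) (sym (ℚ.*-assoc p _ _))

bools : List Bool
bools = false ∷ true ∷ []

∑-allVecs-suc : (xs : List A) (f : Vec A (suc k) → ℚ) →
  ∑ (allVecs xs (suc k)) f ≡ ∑[ x ∈ xs ] ∑[ v ∈ allVecs xs k ] f (x ∷ v)
∑-allVecs-suc {k = k} xs f =
  trans (∑-concatMap _ xs f) (∑-cong xs (λ x → ∑-map (x ∷_) (allVecs xs k) f))

∑-allVecs-bools-suc : (f : Vec Bool (suc k) → ℚ) →
  ∑ (allVecs bools (suc k)) f
    ≡ (∑[ v ∈ allVecs bools k ] f (false ∷ v)) +ℚ (∑[ v ∈ allVecs bools k ] f (true ∷ v))
∑-allVecs-bools-suc {k} f =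
  trans (∑-allVecs-suc bools f) (cong ((∑[ v ∈ allVecs bools k ] f (false ∷ v)) +ℚ_) (ℚ.+-identityʳ _))

∑-allSubsets-suc : (f : Subset (suc n) → ℚ) →
  ∑ (allSubsets (suc n)) f ≡ ∑[ s ∈ allSubsets n ] ∑[ b ∈ bools ] f (b ∷ s)
∑-allSubsets-suc {n} f = ∑-concatMap _ (allSubsets n) f

-- An outcome for the elements of Fin (suc n) is the trajectory of element zero zipped with an outcome
-- for the remaining elements.
∑-allVecs-allSubsets-suc : (f : Vec (Subset (suc n)) k → ℚ) →
  ∑ (allVecs (allSubsets (suc n)) k) f
    ≡ ∑[ c ∈ allVecs bools k ] ∑[ ω ∈ allVecs (allSubsets n) k ] f (zipWith _∷_ c ω)
∑-allVecs-allSubsets-suc {k = zero}  f = sym (ℚ.+-identityʳ _)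
∑-allVecs-allSubsets-suc {n} {k = suc k} f = begin
  ∑ (allVecs S′ (suc k)) f
    ≡⟨ ∑-allVecs-suc S′ f ⟩
  ∑[ X ∈ S′ ] ∑[ V ∈ allVecs S′ k ] f (X ∷ V)
    ≡⟨ ∑-allSubsets-suc (λ X → ∑[ V ∈ allVecs S′ k ] f (X ∷ V)) ⟩
  ∑[ s ∈ S ] ∑[ b ∈ bools ] ∑[ V ∈ allVecs S′ k ] f ((b ∷ s) ∷ V)
    ≡⟨ ∑-cong S (λ s → ∑-cong bools (λ b → ∑-allVecs-allSubsets-suc (λ V → f ((b ∷ s) ∷ V)))) ⟩
  ∑[ s ∈ S ] ∑[ b ∈ bools ] ∑[ c ∈ Cs ] ∑[ ω ∈ Ωs ] f ((b ∷ s) ∷ zipWith _∷_ c ω)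
    ≡⟨ ∑-comm S bools (λ s b → ∑[ c ∈ Cs ] ∑[ ω ∈ Ωs ] f ((b ∷ s) ∷ zipWith _∷_ c ω)) ⟩
  ∑[ b ∈ bools ] ∑[ s ∈ S ] ∑[ c ∈ Cs ] ∑[ ω ∈ Ωs ] f ((b ∷ s) ∷ zipWith _∷_ c ω)
    ≡⟨ ∑-cong bools (λ b → ∑-comm S Cs (λ s c → ∑[ ω ∈ Ωs ] f ((b ∷ s) ∷ zipWith _∷_ c ω))) ⟩
  ∑[ b ∈ bools ] ∑[ c ∈ Cs ] ∑[ s ∈ S ] ∑[ ω ∈ Ωs ] f (zipWith _∷_ (b ∷ c) (s ∷ ω))
    ≡⟨ ∑-cong bools (λ b → ∑-cong Cs (λ c → ∑-allVecs-suc S (λ ω → f (zipWith _∷_ (b ∷ c) ω)))) ⟨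
  ∑[ b ∈ bools ] ∑[ c ∈ Cs ] ∑[ ω ∈ allVecs S (suc k) ] f (zipWith _∷_ (b ∷ c) ω)
    ≡⟨ ∑-allVecs-suc bools (λ c → ∑[ ω ∈ allVecs S (suc k) ] f (zipWith _∷_ c ω)) ⟨
  ∑[ c ∈ allVecs bools (suc k) ] ∑[ ω ∈ allVecs S (suc k) ] f (zipWith _∷_ c ω) ∎
  where
  open ≡-Reasoning
  S : List (Subset n)
  S = allSubsets n
  S′ : List (Subset (suc n))
  S′ = allSubsets (suc n)
  Cs : List (Vec Bool k)
  Cs = allVecs bools k
  Ωs : List (Vec (Subset n) k)
  Ωs = allVecs S k

trajectoryProb : ℚ → Bool → Vec Bool k → ℚ
trajectoryProb p b []       = 1ℚ
trajectoryProb p b (c ∷ cs) = elemStep p b c *ℚ trajectoryProb p c cs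

columnProb : ℚ → Vec Bool (suc k) → ℚ
columnProb p (b ∷ cs) = ½ *ℚ trajectoryProb p b cs

columnPr : (T : ℕ) → ℚ → (Vec Bool (suc T) → Bool) → ℚ
columnPr T p e = ∑[ c ∈ allVecs bools (suc T) ] 𝟙 (e c) (columnProb p c)

columnPr-cong : ∀ T p {e e′ : Vec Bool (suc T) → Bool} → (∀ c → e c ≡ e′ c) → columnPr T p e ≡ columnPr T p e′
columnPr-cong T p e≗e′ = ∑-cong (allVecs bools (suc T)) (λ c → cong (λ b → 𝟙 b _) (e≗e′ c))

Pr-cong : ∀ n T p {E E′ : Outcome n T → Bool} → (∀ ω → E ω ≡ E′ ω) → Pr n T p E ≡ Pr n T p E′
Pr-cong n T p E≗E′ = ∑-cong (allOutcomes n T) (λ ω → cong (λ b → 𝟙 b _) (E≗E′ ω))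

private
  *-interchange : ∀ a b c d → (a *ℚ b) *ℚ (c *ℚ d) ≡ (a *ℚ c) *ℚ (b *ℚ d)
  *-interchange = solve 4 (λ a b c d → (a :* b) :* (c :* d) := (a :* c) :* (b :* d)) refl

chainProb-zipWith : ∀ p b (s : Subset n) (cs : Vec Bool k) ωs →
  chainProb p (b ∷ s) (zipWith _∷_ cs ωs) ≡ trajectoryProb p b cs *ℚ chainProb p s ωs
chainProb-zipWith p b s []       []       = refl
chainProb-zipWith p b s (c ∷ cs) (ω ∷ ωs) =
  trans (cong (elemStep p b c *ℚ stepProb p s ω *ℚ_) (chainProb-zipWith p c ω cs ωs))
        (*-interchange (elemStep p b c) (stepProb p s ω) (trajectoryProb p c cs) (chainProb p ω ωs))

outcomeProb-zipWith : ∀ {T} p (c : Vec Bool (suc T)) (ω : Outcome n T) →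
  outcomeProb p (zipWith _∷_ c ω) ≡ columnProb p c *ℚ outcomeProb p ω
outcomeProb-zipWith {n} p (b ∷ cs) (s ∷ ωs) =
  trans (cong (½ *ℚ ½ ^ℚ n *ℚ_) (chainProb-zipWith p b s cs ωs))
        (*-interchange ½ (½ ^ℚ n) (trajectoryProb p b cs) (chainProb p s ωs))

Pr-split : ∀ n T p (E : Outcome (suc n) T → Bool) (e : Vec Bool (suc T) → Bool) (E′ : Outcome n T → Bool) →
  (∀ c ω → E (zipWith _∷_ c ω) ≡ e c ∧ E′ ω) → Pr (suc n) T p E ≡ columnPr T p e *ℚ Pr n T p E′
Pr-split n T p E e E′ E-split = begin
  Pr (suc n) T p E
    ≡⟨ ∑-allVecs-allSubsets-suc (λ ω → 𝟙 (E ω) (outcomeProb p ω)) ⟩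
  ∑[ c ∈ Cs ] ∑[ ω ∈ Ωs ] 𝟙 (E (zipWith _∷_ c ω)) (outcomeProb p (zipWith _∷_ c ω))
    ≡⟨ ∑-cong Cs (λ c → ∑-cong Ωs (λ ω → factor c ω)) ⟩
  ∑[ c ∈ Cs ] ∑[ ω ∈ Ωs ] 𝟙 (e c) (columnProb p c) *ℚ 𝟙 (E′ ω) (outcomeProb p ω)
    ≡⟨ ∑-cong Cs (λ c → *-distribˡ-∑ (𝟙 (e c) (columnProb p c)) Ωs (λ ω → 𝟙 (E′ ω) (outcomeProb p ω))) ⟨
  ∑[ c ∈ Cs ] 𝟙 (e c) (columnProb p c) *ℚ Pr n T p E′
    ≡⟨ *-distribʳ-∑ (Pr n T p E′) Cs (λ c → 𝟙 (e c) (columnProb p c)) ⟨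
  columnPr T p e *ℚ Pr n T p E′ ∎
  where
  open ≡-Reasoning
  Cs : List (Vec Bool (suc T))
  Cs = allVecs bools (suc T)
  Ωs : List (Outcome n T)
  Ωs = allOutcomes n T
  factor : ∀ c ω → 𝟙 (E (zipWith _∷_ c ω)) (outcomeProb p (zipWith _∷_ c ω))
                   ≡ 𝟙 (e c) (columnProb p c) *ℚ 𝟙 (E′ ω) (outcomeProb p ω)
  factor c ω = trans (cong₂ 𝟙 (E-split c ω) (outcomeProb-zipWith p c ω)) (𝟙-∧ (e c) (E′ ω) _ _)

module _ {p : ℚ} (0≤p : 0ℚ ≤ℚ p) (0≤1-p : 0ℚ ≤ℚ 1ℚ -ℚ p) where

  elemStep-nonneg : ∀ a b → 0ℚ ≤ℚ elemStep p a b
  elemStep-nonneg true  true  = 0≤p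
  elemStep-nonneg true  false = 0≤1-p
  elemStep-nonneg false true  = ℚ.≤-refl
  elemStep-nonneg false false = 0≤1

  chainProb-nonneg : (A : Subset n) (As : Vec (Subset n) k) → 0ℚ ≤ℚ chainProb p A As
  chainProb-nonneg A []       = 0≤1
  chainProb-nonneg A (B ∷ Bs) = nonneg-* (stepProb-nonneg A B) (chainProb-nonneg B Bs)
    where
    stepProb-nonneg : (A B : Subset n) → 0ℚ ≤ℚ stepProb p A B
    stepProb-nonneg []      []      = 0≤1
    stepProb-nonneg (a ∷ A) (b ∷ B) = nonneg-* (elemStep-nonneg a b) (stepProb-nonneg A B)

  Pr-nonneg : ∀ n T E → 0ℚ ≤ℚ Pr n T p E
  Pr-nonneg n T E = ∑-nonneg (allOutcomes n T) (λ ω → 𝟙-nonneg (E ω) (outcomeProb-nonneg ω))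
    where
    ½^-nonneg : ∀ n → 0ℚ ≤ℚ ½ ^ℚ n
    ½^-nonneg zero    = 0≤1
    ½^-nonneg (suc n) = nonneg-* 0≤½ (½^-nonneg n)
    outcomeProb-nonneg : (ω : Outcome n T) → 0ℚ ≤ℚ outcomeProb p ω
    outcomeProb-nonneg (A ∷ As) = nonneg-* (½^-nonneg n) (chainProb-nonneg A As)

  columnPr-nonneg : ∀ T e → 0ℚ ≤ℚ columnPr T p e
  columnPr-nonneg T e = ∑-nonneg (allVecs bools (suc T)) (λ c → 𝟙-nonneg (e c) (columnProb-nonneg c))
    where
    trajectoryProb-nonneg : ∀ b (cs : Vec Bool k) → 0ℚ ≤ℚ trajectoryProb p b cs
    trajectoryProb-nonneg b []       = 0≤1
    trajectoryProb-nonneg b (c ∷ cs) = nonneg-* (elemStep-nonneg b c) (trajectoryProb-nonneg c cs)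
    columnProb-nonneg : (c : Vec Bool (suc k)) → 0ℚ ≤ℚ columnProb p c
    columnProb-nonneg (b ∷ cs) = nonneg-* 0≤½ (trajectoryProb-nonneg b cs)

-- The lifetime of a single element

prefix : (k L : ℕ) → Vec Bool k
prefix zero    L       = []
prefix (suc k) zero    = false ∷ prefix k zero
prefix (suc k) (suc L) = true ∷ prefix k L

lookup-prefix : ∀ k L (t : Fin k) → lookup (prefix k L) t ≡ (toℕ t <ᵇ L)
lookup-prefix (suc k) zero    zero    = refl
lookup-prefix (suc k) zero    (suc t) = lookup-prefix k zero t
lookup-prefix (suc k) (suc L) zero    = refl
lookup-prefix (suc k) (suc L) (suc t) = lookup-prefix k L t

-- Up to probability zero, an element's trajectory is prefix (suc T) L for its lifetime L: it is absent from
-- the start (L = 0) with probability ½, and otherwise survives d = L - 1 further steps, which happens with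
-- probability (1 - p) p^d for d < T and p^T for d = T.
survivalPr : ℚ → ℕ → (ℕ → Bool) → ℚ
survivalPr p zero    h = 𝟙 (h 0) 1ℚ
survivalPr p (suc k) h = (1ℚ -ℚ p) *ℚ 𝟙 (h 0) 1ℚ +ℚ p *ℚ survivalPr p k (λ d → h (suc d))

survivalPr-cong : ∀ p k {h h′ : ℕ → Bool} → (∀ d → h d ≡ h′ d) → survivalPr p k h ≡ survivalPr p k h′
survivalPr-cong p zero    h≗h′ = cong (λ b → 𝟙 b 1ℚ) (h≗h′ 0)
survivalPr-cong p (suc k) h≗h′ =
  cong₂ (λ b s → (1ℚ -ℚ p) *ℚ 𝟙 b 1ℚ +ℚ p *ℚ s) (h≗h′ 0) (survivalPr-cong p k (λ d → h≗h′ (suc d)))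

∑-trajectories-absent : ∀ p k (e : Vec Bool k → Bool) →
  ∑[ cs ∈ allVecs bools k ] 𝟙 (e cs) (trajectoryProb p false cs) ≡ 𝟙 (e (prefix k 0)) 1ℚ
∑-trajectories-absent p zero    e = ℚ.+-identityʳ _
∑-trajectories-absent p (suc k) e = begin
  ∑[ cs ∈ allVecs bools (suc k) ] 𝟙 (e cs) (trajectoryProb p false cs)
    ≡⟨ ∑-allVecs-bools-suc (λ cs → 𝟙 (e cs) (trajectoryProb p false cs)) ⟩
  (∑[ cs ∈ Cs ] 𝟙 (e (false ∷ cs)) (1ℚ *ℚ trajectoryProb p false cs))
    +ℚ (∑[ cs ∈ Cs ] 𝟙 (e (true ∷ cs)) (0ℚ *ℚ trajectoryProb p true cs))
    ≡⟨ cong₂ _+ℚ_ (∑-𝟙-* Cs (λ cs → e (false ∷ cs)) 1ℚ _) (∑-𝟙-* Cs (λ cs → e (true ∷ cs)) 0ℚ _) ⟩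
  1ℚ *ℚ Stay +ℚ 0ℚ *ℚ Enter
    ≡⟨ cong₂ _+ℚ_ (ℚ.*-identityˡ Stay) (ℚ.*-zeroˡ Enter) ⟩
  Stay +ℚ 0ℚ
    ≡⟨ ℚ.+-identityʳ Stay ⟩
  Stay
    ≡⟨ ∑-trajectories-absent p k (λ cs → e (false ∷ cs)) ⟩
  𝟙 (e (prefix (suc k) 0)) 1ℚ ∎
  where
  open ≡-Reasoning
  Cs : List (Vec Bool k)
  Cs = allVecs bools k
  Stay : ℚ
  Stay = ∑[ cs ∈ Cs ] 𝟙 (e (false ∷ cs)) (trajectoryProb p false cs)
  Enter : ℚ
  Enter = ∑[ cs ∈ Cs ] 𝟙 (e (true ∷ cs)) (trajectoryProb p true cs)

∑-trajectories-present : ∀ p k (e : Vec Bool k → Bool) →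
  ∑[ cs ∈ allVecs bools k ] 𝟙 (e cs) (trajectoryProb p true cs) ≡ survivalPr p k (λ d → e (prefix k d))
∑-trajectories-present p zero    e = ℚ.+-identityʳ _
∑-trajectories-present p (suc k) e = begin
  ∑[ cs ∈ allVecs bools (suc k) ] 𝟙 (e cs) (trajectoryProb p true cs)
    ≡⟨ ∑-allVecs-bools-suc (λ cs → 𝟙 (e cs) (trajectoryProb p true cs)) ⟩
  (∑[ cs ∈ Cs ] 𝟙 (e (false ∷ cs)) ((1ℚ -ℚ p) *ℚ trajectoryProb p false cs))
    +ℚ (∑[ cs ∈ Cs ] 𝟙 (e (true ∷ cs)) (p *ℚ trajectoryProb p true cs))
    ≡⟨ cong₂ _+ℚ_ (∑-𝟙-* Cs (λ cs → e (false ∷ cs)) (1ℚ -ℚ p) _) (∑-𝟙-* Cs (λ cs → e (true ∷ cs)) p _) ⟩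
  (1ℚ -ℚ p) *ℚ (∑[ cs ∈ Cs ] 𝟙 (e (false ∷ cs)) (trajectoryProb p false cs))
    +ℚ p *ℚ (∑[ cs ∈ Cs ] 𝟙 (e (true ∷ cs)) (trajectoryProb p true cs))
    ≡⟨ cong₂ (λ a s → (1ℚ -ℚ p) *ℚ a +ℚ p *ℚ s)
             (∑-trajectories-absent p k (λ cs → e (false ∷ cs)))
             (∑-trajectories-present p k (λ cs → e (true ∷ cs))) ⟩
  survivalPr p (suc k) (λ d → e (prefix (suc k) d)) ∎
  where
  open ≡-Reasoning
  Cs : List (Vec Bool k)
  Cs = allVecs bools k

lifetimePr : (T : ℕ) → ℚ → (ℕ → Bool) → ℚ
lifetimePr T p h = ½ *ℚ 𝟙 (h 0) 1ℚ +ℚ ½ *ℚ survivalPr p T (λ d → h (suc d))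

columnPr-lifetime : ∀ T p (e : Vec Bool (suc T) → Bool) → columnPr T p e ≡ lifetimePr T p (λ L → e (prefix (suc T) L))
columnPr-lifetime T p e = begin
  columnPr T p e
    ≡⟨ ∑-allVecs-bools-suc (λ c → 𝟙 (e c) (columnProb p c)) ⟩
  (∑[ cs ∈ Cs ] 𝟙 (e (false ∷ cs)) (½ *ℚ trajectoryProb p false cs))
    +ℚ (∑[ cs ∈ Cs ] 𝟙 (e (true ∷ cs)) (½ *ℚ trajectoryProb p true cs))
    ≡⟨ cong₂ _+ℚ_ (∑-𝟙-* Cs (λ cs → e (false ∷ cs)) ½ _) (∑-𝟙-* Cs (λ cs → e (true ∷ cs)) ½ _) ⟩
  ½ *ℚ (∑[ cs ∈ Cs ] 𝟙 (e (false ∷ cs)) (trajectoryProb p false cs))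
    +ℚ ½ *ℚ (∑[ cs ∈ Cs ] 𝟙 (e (true ∷ cs)) (trajectoryProb p true cs))
    ≡⟨ cong₂ (λ a s → ½ *ℚ a +ℚ ½ *ℚ s)
             (∑-trajectories-absent p T (λ cs → e (false ∷ cs)))
             (∑-trajectories-present p T (λ cs → e (true ∷ cs))) ⟩
  lifetimePr T p (λ L → e (prefix (suc T) L)) ∎
  where
  open ≡-Reasoning
  Cs : List (Vec Bool T)
  Cs = allVecs bools T

columnPr-via-lifetime : ∀ T p (e : Vec Bool (suc T) → Bool) (h : ℕ → Bool) →
  (∀ L → e (prefix (suc T) L) ≡ h L) → columnPr T p e ≡ lifetimePr T p h
columnPr-via-lifetime T p e h e≗h = trans (columnPr-lifetime T p e)
  (cong₂ (λ b s → ½ *ℚ 𝟙 b 1ℚ +ℚ ½ *ℚ s) (e≗h 0) (survivalPr-cong p T (λ d → e≗h (suc d))))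

survivalPr-window : ∀ p k a b → a ≤ b → b ≤ k →
  survivalPr p k (λ d → (a <ᵇ suc d) ∧ (d <ᵇ b)) ≡ p ^ℚ a -ℚ p ^ℚ b
survivalPr-window p zero    zero    zero    z≤n       z≤n       = sym (ℚ.+-inverseʳ 1ℚ)
survivalPr-window p (suc k) zero    zero    z≤n       z≤n       =
  trans (cong (λ s → (1ℚ -ℚ p) *ℚ 0ℚ +ℚ p *ℚ s) (survivalPr-window p k 0 0 z≤n z≤n))
        (solve 1 (λ x → (con 1ℚ :- x) :* con 0ℚ :+ x :* (con 1ℚ :- con 1ℚ) := con 1ℚ :- con 1ℚ) refl p)
survivalPr-window p (suc k) zero    (suc b) z≤n       (s≤s b≤k) =
  trans (cong (λ s → (1ℚ -ℚ p) *ℚ 1ℚ +ℚ p *ℚ s) (survivalPr-window p k 0 b z≤n b≤k))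
        (solve 2 (λ x y → (con 1ℚ :- x) :* con 1ℚ :+ x :* (con 1ℚ :- y) := con 1ℚ :- x :* y) refl p (p ^ℚ b))
survivalPr-window p (suc k) (suc a) (suc b) (s≤s a≤b) (s≤s b≤k) =
  trans (cong (λ s → (1ℚ -ℚ p) *ℚ 0ℚ +ℚ p *ℚ s) (survivalPr-window p k a b a≤b b≤k))
        (solve 3 (λ x y z → (con 1ℚ :- x) :* con 0ℚ :+ x :* (y :- z) := x :* y :- x :* z) refl p (p ^ℚ a) (p ^ℚ b))

lifetimePr-window : ∀ T p a b → a ≤ b → b ≤ T →
  lifetimePr T p (λ L → (a <ᵇ L) ∧ (L ≤ᵇ b)) ≡ ½ *ℚ (p ^ℚ a -ℚ p ^ℚ b)
lifetimePr-window T p a b a≤b b≤T =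
  trans (ℚ.+-identityˡ _) (cong (½ *ℚ_) (survivalPr-window p T a b a≤b b≤T))

lifetimePr-atMost : ∀ T p b → b ≤ T → lifetimePr T p (λ L → L ≤ᵇ b) ≡ 1ℚ -ℚ ½ *ℚ p ^ℚ b
lifetimePr-atMost T p b b≤T =
  trans (cong (λ s → ½ *ℚ 1ℚ +ℚ ½ *ℚ s) (survivalPr-window p T 0 b z≤n b≤T))
        (solve 1 (λ x → con ½ :* con 1ℚ :+ con ½ :* (con 1ℚ :- x) := con 1ℚ :- con ½ :* x) refl (p ^ℚ b))

-- Conditioning on observations

Observation : ℕ → ℕ → Set
Observation n T = List (Fin (suc T) × Subset n)

observed : ∀ {T} → Observation n T → Outcome n T → Bool
observed []              ω = true
observed ((t , B) ∷ obs) ω = ⌊ lookup ω t ≟ˢ B ⌋ ∧ observed obs ω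

consistent : ∀ {T} → Observation n T → Fin n → Vec Bool (suc T) → Bool
consistent []              x c = true
consistent ((t , B) ∷ obs) x c = ⌊ lookup c t Bool.≟ lookup B x ⌋ ∧ consistent obs x c

forgetFirst : ∀ {T} → Observation (suc n) T → Observation n T
forgetFirst = map (map₂ tail)

≟ˢ-∷ : ∀ a b (A B : Subset n) → ⌊ (a ∷ A) ≟ˢ (b ∷ B) ⌋ ≡ ⌊ a Bool.≟ b ⌋ ∧ ⌊ A ≟ˢ B ⌋
≟ˢ-∷ a b A B =
  trans (isYes≗does ((a ∷ A) ≟ˢ (b ∷ B))) (sym (cong₂ _∧_ (isYes≗does (a Bool.≟ b)) (isYes≗does (A ≟ˢ B))))

observed-zipWith : ∀ {T} (obs : Observation (suc n) T) c ω →
  observed obs (zipWith _∷_ c ω) ≡ consistent obs zero c ∧ observed (forgetFirst obs) ω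
observed-zipWith []                  c ω = refl
observed-zipWith ((t , b ∷ B) ∷ obs) c ω = begin
  ⌊ lookup (zipWith _∷_ c ω) t ≟ˢ (b ∷ B) ⌋ ∧ observed obs (zipWith _∷_ c ω)
    ≡⟨ cong₂ _∧_ (cong (λ A → ⌊ A ≟ˢ (b ∷ B) ⌋) (Vec.lookup-zipWith _∷_ t c ω)) (observed-zipWith obs c ω) ⟩
  ⌊ (lookup c t ∷ lookup ω t) ≟ˢ (b ∷ B) ⌋ ∧ (consistent obs zero c ∧ observed (forgetFirst obs) ω)
    ≡⟨ cong (_∧ (consistent obs zero c ∧ observed (forgetFirst obs) ω)) (≟ˢ-∷ (lookup c t) b (lookup ω t) B) ⟩
  (⌊ lookup c t Bool.≟ b ⌋ ∧ ⌊ lookup ω t ≟ˢ B ⌋) ∧ (consistent obs zero c ∧ observed (forgetFirst obs) ω)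
    ≡⟨ interchange ⌊ lookup c t Bool.≟ b ⌋ ⌊ lookup ω t ≟ˢ B ⌋ (consistent obs zero c) (observed (forgetFirst obs) ω) ⟩
  (⌊ lookup c t Bool.≟ b ⌋ ∧ consistent obs zero c) ∧ (⌊ lookup ω t ≟ˢ B ⌋ ∧ observed (forgetFirst obs) ω) ∎
  where open ≡-Reasoning

consistent-forgetFirst : ∀ {T} (obs : Observation (suc n) T) x c →
  consistent (forgetFirst obs) x c ≡ consistent obs (suc x) c
consistent-forgetFirst []                  x c = refl
consistent-forgetFirst ((t , b ∷ B) ∷ obs) x c =
  cong (⌊ lookup c t Bool.≟ lookup B x ⌋ ∧_) (consistent-forgetFirst obs x c)

Pr-observed-split : ∀ {T p} (obs : Observation (suc n) T) →
  Pr (suc n) T p (observed obs) ≡ columnPr T p (consistent obs zero) *ℚ Pr n T p (observed (forgetFirst obs))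
Pr-observed-split {n} {T} {p} obs =
  Pr-split n T p (observed obs) (consistent obs zero) (observed (forgetFirst obs)) (observed-zipWith obs)

-- Elements evolve independently, so conditioning on observations of the whole sets
-- only conditions the trajectory of x on the observations of x itself.
columnBound⇒bound : ∀ {p} → 0ℚ ≤ℚ p → 0ℚ ≤ℚ 1ℚ -ℚ p →
  ∀ {T} (c : ℚ) (obs : Observation n T) (s : Fin (suc T)) (x : Fin n) →
  c *ℚ columnPr T p (consistent obs x) ≤ℚ columnPr T p (λ col → consistent obs x col ∧ lookup col s) →
  c *ℚ Pr n T p (observed obs) ≤ℚ Pr n T p (λ ω → observed obs ω ∧ (x ∈ᵇ lookup ω s))
columnBound⇒bound {suc n} {p} 0≤p 0≤q {T} c obs s zero bound = begin
  c *ℚ Pr (suc n) T p (observed obs)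
    ≡⟨ cong (c *ℚ_) (Pr-observed-split obs) ⟩
  c *ℚ (columnPr T p (consistent obs zero) *ℚ Rest)
    ≡⟨ ℚ.*-assoc c _ Rest ⟨
  c *ℚ columnPr T p (consistent obs zero) *ℚ Rest
    ≤⟨ *-monoʳ-≤-nonneg (Pr-nonneg 0≤p 0≤q n T (observed (forgetFirst obs))) bound ⟩
  columnPr T p (λ col → consistent obs zero col ∧ lookup col s) *ℚ Rest
    ≡⟨ Pr-split n T p (λ ω → observed obs ω ∧ (zero ∈ᵇ lookup ω s)) (λ col → consistent obs zero col ∧ lookup col s)
                  (observed (forgetFirst obs)) split ⟨
  Pr (suc n) T p (λ ω → observed obs ω ∧ (zero ∈ᵇ lookup ω s)) ∎
  where
  open ℚ.≤-Reasoning
  Rest : ℚ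
  Rest = Pr n T p (observed (forgetFirst obs))
  split : ∀ col ω → observed obs (zipWith _∷_ col ω) ∧ (zero ∈ᵇ lookup (zipWith _∷_ col ω) s)
                    ≡ (consistent obs zero col ∧ lookup col s) ∧ observed (forgetFirst obs) ω
  split col ω = trans
    (cong₂ _∧_ (observed-zipWith obs col ω) (cong (λ A → lookup A zero) (Vec.lookup-zipWith _∷_ s col ω)))
    (xy∙z≈xz∙y (consistent obs zero col) (observed (forgetFirst obs) ω) (lookup col s))
columnBound⇒bound {suc n} {p} 0≤p 0≤q {T} c obs s (suc x) bound = begin
  c *ℚ Pr (suc n) T p (observed obs)
    ≡⟨ cong (c *ℚ_) (Pr-observed-split obs) ⟩
  c *ℚ (First *ℚ Pr n T p (observed obs′))
    ≡⟨ solve 3 (λ a b r → a :* (b :* r) := b :* (a :* r)) refl c First (Pr n T p (observed obs′)) ⟩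
  First *ℚ (c *ℚ Pr n T p (observed obs′))
    ≤⟨ *-monoˡ-≤-nonneg (columnPr-nonneg 0≤p 0≤q T (consistent obs zero))
                        (columnBound⇒bound 0≤p 0≤q c obs′ s x bound′) ⟩
  First *ℚ Pr n T p (λ ω → observed obs′ ω ∧ (x ∈ᵇ lookup ω s))
    ≡⟨ Pr-split n T p (λ ω → observed obs ω ∧ (suc x ∈ᵇ lookup ω s)) (consistent obs zero)
                  (λ ω → observed obs′ ω ∧ (x ∈ᵇ lookup ω s)) split ⟨
  Pr (suc n) T p (λ ω → observed obs ω ∧ (suc x ∈ᵇ lookup ω s)) ∎
  where
  open ℚ.≤-Reasoning
  obs′ : Observation n T
  obs′ = forgetFirst obs
  First : ℚ
  First = columnPr T p (consistent obs zero)
  bound′ : c *ℚ columnPr T p (consistent obs′ x) ≤ℚ columnPr T p (λ col → consistent obs′ x col ∧ lookup col s)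
  bound′ = begin
    c *ℚ columnPr T p (consistent obs′ x)
      ≡⟨ cong (c *ℚ_) (columnPr-cong T p (consistent-forgetFirst obs x)) ⟩
    c *ℚ columnPr T p (consistent obs (suc x))
      ≤⟨ bound ⟩
    columnPr T p (λ col → consistent obs (suc x) col ∧ lookup col s)
      ≡⟨ columnPr-cong T p (λ col → cong (_∧ lookup col s) (consistent-forgetFirst obs x col)) ⟨
    columnPr T p (λ col → consistent obs′ x col ∧ lookup col s) ∎
  split : ∀ col ω → observed obs (zipWith _∷_ col ω) ∧ (suc x ∈ᵇ lookup (zipWith _∷_ col ω) s)
                    ≡ consistent obs zero col ∧ (observed obs′ ω ∧ (x ∈ᵇ lookup ω s))
  split col ω = trans
    (cong₂ _∧_ (observed-zipWith obs col ω) (cong (λ A → lookup A (suc x)) (Vec.lookup-zipWith _∷_ s col ω)))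
    (Bool.∧-assoc (consistent obs zero col) (observed obs′ ω) (x ∈ᵇ lookup ω s))

-- Inequalities between powers of p

^-nonneg : ∀ {p} → 0ℚ ≤ℚ p → ∀ k → 0ℚ ≤ℚ p ^ℚ k
^-nonneg 0≤p zero    = 0≤1
^-nonneg 0≤p (suc k) = nonneg-* 0≤p (^-nonneg 0≤p k)

module _ {p : ℚ} (0≤p : 0ℚ ≤ℚ p) (0≤q : 0ℚ ≤ℚ 1ℚ -ℚ p) where

  bernoulli : ∀ k → 1ℚ -ℚ fromℕ k *ℚ (1ℚ -ℚ p) ≤ℚ p ^ℚ k
  bernoulli zero    = ℚ.≤-reflexive (solve 1 (λ x → con 1ℚ :- con 0ℚ :* (con 1ℚ :- x) := con 1ℚ) refl p)
  bernoulli (suc k) = begin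
    1ℚ -ℚ fromℕ (suc k) *ℚ (1ℚ -ℚ p)
      ≡⟨ cong (λ z → 1ℚ -ℚ z *ℚ (1ℚ -ℚ p)) (fromℕ-suc k) ⟩
    1ℚ -ℚ (1ℚ +ℚ fromℕ k) *ℚ (1ℚ -ℚ p)
      ≤⟨ ≤-by-gap (fromℕ k *ℚ (1ℚ -ℚ p) *ℚ (1ℚ -ℚ p)) (nonneg-* (nonneg-* (fromℕ-nonneg k) 0≤q) 0≤q)
           (solve 2 (λ x y → x :* (con 1ℚ :- y :* (con 1ℚ :- x))
                               := (con 1ℚ :- (con 1ℚ :+ y) :* (con 1ℚ :- x)) :+ y :* (con 1ℚ :- x) :* (con 1ℚ :- x))
                  refl p (fromℕ k)) ⟩
    p *ℚ (1ℚ -ℚ fromℕ k *ℚ (1ℚ -ℚ p))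
      ≤⟨ *-monoˡ-≤-nonneg 0≤p (bernoulli k) ⟩
    p ^ℚ suc k ∎
    where open ℚ.≤-Reasoning

  1-p^k≤k*q : ∀ k → 1ℚ -ℚ p ^ℚ k ≤ℚ fromℕ k *ℚ (1ℚ -ℚ p)
  1-p^k≤k*q k = ≤-by-gap (p ^ℚ k -ℚ (1ℚ -ℚ fromℕ k *ℚ (1ℚ -ℚ p))) (p≤q⇒0≤q-p (bernoulli k))
    (solve 2 (λ w a → a := (con 1ℚ :- w) :+ (w :- (con 1ℚ :- a))) refl (p ^ℚ k) (fromℕ k *ℚ (1ℚ -ℚ p)))

  -- 1 - p^(m+1) = (1 - p)(1 + p + ⋯ + p^m), and every term of the sum is at least p^m.
  geometric : ∀ m → fromℕ (suc m) *ℚ (1ℚ -ℚ p) *ℚ p ^ℚ m ≤ℚ 1ℚ -ℚ p ^ℚ suc m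
  geometric zero    = ℚ.≤-reflexive
    (solve 1 (λ x → con 1ℚ :* (con 1ℚ :- x) :* con 1ℚ := con 1ℚ :- x :* con 1ℚ) refl p)
  geometric (suc m) = begin
    fromℕ (suc (suc m)) *ℚ q *ℚ p ^ℚ suc m
      ≡⟨ cong (λ z → z *ℚ q *ℚ p ^ℚ suc m) (fromℕ-suc (suc m)) ⟩
    (1ℚ +ℚ M) *ℚ q *ℚ (p *ℚ X)
      ≤⟨ ≤-by-gap ((1ℚ -ℚ p *ℚ X -ℚ M *ℚ q *ℚ X) +ℚ M *ℚ q *ℚ q *ℚ X)
           (nonneg-+ (p≤q⇒0≤q-p (geometric m))
                     (nonneg-* (nonneg-* (nonneg-* (fromℕ-nonneg (suc m)) 0≤q) 0≤q) (^-nonneg 0≤p m)))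
           (solve 3 (λ x a w → con 1ℚ :- x :* (x :* w)
                               := (con 1ℚ :+ a) :* (con 1ℚ :- x) :* (x :* w)
                                  :+ ((con 1ℚ :- x :* w :- a :* (con 1ℚ :- x) :* w)
                                      :+ a :* (con 1ℚ :- x) :* (con 1ℚ :- x) :* w))
                  refl p M X) ⟩
    1ℚ -ℚ p ^ℚ suc (suc m) ∎
    where
    open ℚ.≤-Reasoning
    q : ℚ
    q = 1ℚ -ℚ p
    M : ℚ
    M = fromℕ (suc m)
    X : ℚ
    X = p ^ℚ m

module Bounds {T : ℕ} {p : ℚ} (1≤T : 1 ≤ T) (p≤1 : p ≤ℚ 1ℚ) (qT≤1 : (1ℚ -ℚ p) *ℚ fromℕ T ≤ℚ 1ℚ) where

  q : ℚ
  q = 1ℚ -ℚ p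

  0≤q : 0ℚ ≤ℚ q
  0≤q = p≤q⇒0≤q-p p≤1

  q*m≤1 : ∀ {m} → m ≤ T → q *ℚ fromℕ m ≤ℚ 1ℚ
  q*m≤1 m≤T = ℚ.≤-trans (*-monoˡ-≤-nonneg 0≤q (fromℕ-mono m≤T)) qT≤1

  q*m≤p : ∀ {m} → suc m ≤ T → q *ℚ fromℕ m ≤ℚ p
  q*m≤p {m} m<T = ≤-by-gap (1ℚ -ℚ q *ℚ (1ℚ +ℚ fromℕ m))
    (ℚ.≤-trans (p≤q⇒0≤q-p (q*m≤1 m<T)) (ℚ.≤-reflexive (cong (λ z → 1ℚ -ℚ q *ℚ z) (fromℕ-suc m))))
    (solve 2 (λ x y → x := (con 1ℚ :- x) :* y :+ (con 1ℚ :- (con 1ℚ :- x) :* (con 1ℚ :+ y))) refl p (fromℕ m))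

  0≤p : 0ℚ ≤ℚ p
  0≤p = ℚ.≤-trans (ℚ.≤-reflexive (sym (ℚ.*-zeroʳ q))) (q*m≤p 1≤T)

  -- With x = (1 - p) k, the quantity p^k (p² + x p + x²) does not decrease while x ≤ p,
  -- so p² ≤ p^k (p² + x p + x²) ≤ 3 p^(k + 2).
  private
    G : ℕ → ℚ
    G k = p *ℚ p +ℚ (q *ℚ fromℕ k) *ℚ p +ℚ (q *ℚ fromℕ k) *ℚ (q *ℚ fromℕ k)

    G-step : ∀ k → suc (suc k) ≤ T → G k ≤ℚ p *ℚ G (suc k)
    G-step k k+1<T = begin
      G k
        ≤⟨ ≤-by-gap (q *ℚ q *ℚ (p *ℚ (1ℚ +ℚ fromℕ k) -ℚ q *ℚ fromℕ k *ℚ fromℕ k))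
                    (nonneg-* (nonneg-* 0≤q 0≤q) (p≤q⇒0≤q-p qkk≤p[1+k]))
             (solve 2 (λ x y → x :* (x :* x :+ ((con 1ℚ :- x) :* (con 1ℚ :+ y)) :* x
                                     :+ ((con 1ℚ :- x) :* (con 1ℚ :+ y)) :* ((con 1ℚ :- x) :* (con 1ℚ :+ y)))
                                 := (x :* x :+ ((con 1ℚ :- x) :* y) :* x :+ ((con 1ℚ :- x) :* y) :* ((con 1ℚ :- x) :* y))
                                    :+ (con 1ℚ :- x) :* (con 1ℚ :- x) :* (x :* (con 1ℚ :+ y) :- (con 1ℚ :- x) :* y :* y))
                    refl p (fromℕ k)) ⟩
      p *ℚ (p *ℚ p +ℚ (q *ℚ (1ℚ +ℚ fromℕ k)) *ℚ p +ℚ (q *ℚ (1ℚ +ℚ fromℕ k)) *ℚ (q *ℚ (1ℚ +ℚ fromℕ k)))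
        ≡⟨ cong (λ z → p *ℚ (p *ℚ p +ℚ (q *ℚ z) *ℚ p +ℚ (q *ℚ z) *ℚ (q *ℚ z))) (fromℕ-suc k) ⟨
      p *ℚ G (suc k) ∎
      where
      open ℚ.≤-Reasoning
      qkk≤p[1+k] : q *ℚ fromℕ k *ℚ fromℕ k ≤ℚ p *ℚ (1ℚ +ℚ fromℕ k)
      qkk≤p[1+k] = ℚ.≤-trans (*-monoʳ-≤-nonneg (fromℕ-nonneg k) (q*m≤p (ℕ.<⇒≤ k+1<T)))
        (≤-by-gap p 0≤p (solve 2 (λ x y → x :* (con 1ℚ :+ y) := x :* y :+ x) refl p (fromℕ k)))

    p²≤p^k*G : ∀ k → suc k ≤ T → p *ℚ p ≤ℚ p ^ℚ k *ℚ G k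
    p²≤p^k*G zero    _     = ℚ.≤-reflexive
      (solve 2 (λ x y → x :* x := con 1ℚ :* (x :* x :+ (y :* con 0ℚ) :* x :+ (y :* con 0ℚ) :* (y :* con 0ℚ))) refl p q)
    p²≤p^k*G (suc k) k<T = begin
      p *ℚ p                         ≤⟨ p²≤p^k*G k (ℕ.<⇒≤ k<T) ⟩
      p ^ℚ k *ℚ G k                  ≤⟨ *-monoˡ-≤-nonneg (^-nonneg 0≤p k) (G-step k k<T) ⟩
      p ^ℚ k *ℚ (p *ℚ G (suc k))     ≡⟨ solve 3 (λ a b c → a :* (b :* c) := (b :* a) :* c) refl (p ^ℚ k) p (G (suc k)) ⟩
      p ^ℚ suc k *ℚ G (suc k)        ∎
      where open ℚ.≤-Reasoning

    G≤3p² : ∀ k → suc k ≤ T → G k ≤ℚ fromℕ 3 *ℚ (p *ℚ p)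
    G≤3p² k k<T = begin
      p *ℚ p +ℚ x *ℚ p +ℚ x *ℚ x
        ≤⟨ ℚ.+-mono-≤ (ℚ.+-monoʳ-≤ (p *ℚ p) (*-monoʳ-≤-nonneg 0≤p x≤p))
                      (ℚ.≤-trans (*-monoʳ-≤-nonneg 0≤x x≤p) (*-monoˡ-≤-nonneg 0≤p x≤p)) ⟩
      p *ℚ p +ℚ p *ℚ p +ℚ p *ℚ p
        ≡⟨ solve 1 (λ y → y :+ y :+ y := con (fromℕ 3) :* y) refl (p *ℚ p) ⟩
      fromℕ 3 *ℚ (p *ℚ p) ∎
      where
      open ℚ.≤-Reasoning
      x : ℚ
      x = q *ℚ fromℕ k
      x≤p : x ≤ℚ p
      x≤p = q*m≤p k<T
      0≤x : 0ℚ ≤ℚ x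
      0≤x = nonneg-* 0≤q (fromℕ-nonneg k)

  1≤3*p^k : ∀ k → suc k ≤ T → 1ℚ ≤ℚ fromℕ 3 *ℚ p ^ℚ k
  1≤3*p^k zero    _   =
    ≤-by-gap (fromℕ 2) (fromℕ-nonneg 2) (solve 0 (con (fromℕ 3) :* con 1ℚ := con 1ℚ :+ con (fromℕ 2)) refl)
  1≤3*p^k (suc k) k<T = ℚ.*-cancelʳ-≤-pos (p *ℚ p) {{p²-positive}} (begin
    1ℚ *ℚ (p *ℚ p)                     ≡⟨ ℚ.*-identityˡ (p *ℚ p) ⟩
    p *ℚ p                             ≤⟨ p²≤p^k*G (suc k) k<T ⟩
    p ^ℚ suc k *ℚ G (suc k)            ≤⟨ *-monoˡ-≤-nonneg (^-nonneg 0≤p (suc k)) (G≤3p² (suc k) k<T) ⟩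
    p ^ℚ suc k *ℚ (fromℕ 3 *ℚ (p *ℚ p)) ≡⟨ solve 2 (λ a b → a :* (con (fromℕ 3) :* b) := (con (fromℕ 3) :* a) :* b)
                                                  refl (p ^ℚ suc k) (p *ℚ p) ⟩
    fromℕ 3 *ℚ p ^ℚ suc k *ℚ (p *ℚ p)  ∎)
    where
    open ℚ.≤-Reasoning
    ½≤p : ½ ≤ℚ p
    ½≤p = ≤-by-gap (½ *ℚ (1ℚ -ℚ q *ℚ fromℕ 2))
                   (nonneg-* 0≤½ (p≤q⇒0≤q-p (q*m≤1 (ℕ.≤-trans (s≤s (s≤s z≤n)) k<T))))
      (solve 1 (λ x → x := con ½ :+ con ½ :* (con 1ℚ :- (con 1ℚ :- x) :* con (fromℕ 2))) refl p)
    p-positive : ℚ.Positive p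
    p-positive = ℚ.positive (ℚ.<-≤-trans (ℚ.*<* (ℤ.+<+ (s≤s z≤n))) ½≤p)
    p²-positive : ℚ.Positive (p *ℚ p)
    p²-positive = ℚ.pos*pos⇒pos p {{p-positive}} p {{p-positive}}

  K/6*q≤1 : ∀ K → K ≤ T → (K /ℕ 6) *ℚ q ≤ℚ 1ℚ
  K/6*q≤1 K K≤T = begin
    (K /ℕ 6) *ℚ q
      ≤⟨ ≤-by-gap ((K /ℕ 6) *ℚ q *ℚ fromℕ 5) (nonneg-* (nonneg-* (/ℕ-nonneg K 6) 0≤q) (fromℕ-nonneg 5))
           (solve 1 (λ x → x :* con (fromℕ 6) := x :+ x :* con (fromℕ 5)) refl ((K /ℕ 6) *ℚ q)) ⟩
    (K /ℕ 6) *ℚ q *ℚ fromℕ 6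
      ≡⟨ solve 3 (λ a b c → a :* b :* c := b :* (a :* c)) refl (K /ℕ 6) q (fromℕ 6) ⟩
    q *ℚ ((K /ℕ 6) *ℚ fromℕ 6)
      ≡⟨ cong (q *ℚ_) (/ℕ*fromℕ K 6 (s≤s z≤n)) ⟩
    q *ℚ fromℕ K
      ≤⟨ q*m≤1 K≤T ⟩
    1ℚ ∎
    where open ℚ.≤-Reasoning

  T/K*q/2≤1 : ∀ K → 1 ≤ K → (T /ℕ K) *ℚ (q *ℚ ½) ≤ℚ 1ℚ
  T/K*q/2≤1 (suc K) _ = begin
    c
      ≤⟨ ≤-by-gap (c *ℚ fromℕ K) (nonneg-* (nonneg-* (/ℕ-nonneg T (suc K)) (nonneg-* 0≤q 0≤½)) (fromℕ-nonneg K))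
           (trans (cong (c *ℚ_) (fromℕ-suc K)) (solve 2 (λ x y → x :* (con 1ℚ :+ y) := x :+ x :* y) refl c (fromℕ K))) ⟩
    c *ℚ fromℕ (suc K)
      ≡⟨ solve 3 (λ t a k → t :* (a :* con ½) :* k := con ½ :* (a :* (t :* k))) refl (T /ℕ suc K) q (fromℕ (suc K)) ⟩
    ½ *ℚ (q *ℚ ((T /ℕ suc K) *ℚ fromℕ (suc K)))
      ≡⟨ cong (λ z → ½ *ℚ (q *ℚ z)) (/ℕ*fromℕ T (suc K) (s≤s z≤n)) ⟩
    ½ *ℚ (q *ℚ fromℕ T)
      ≤⟨ *-monoˡ-≤-nonneg 0≤½ qT≤1 ⟩
    ½ *ℚ 1ℚ
      ≤⟨ ≤-by-gap ½ 0≤½ refl ⟩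
    1ℚ ∎
    where
    open ℚ.≤-Reasoning
    c = (T /ℕ suc K) *ℚ (q *ℚ ½)

  private
    windowBound-a′ : ∀ I K → I + K ≤ T →
      ((K /ℕ 6) *ℚ q) *ℚ (1ℚ -ℚ ½ *ℚ p ^ℚ (I + K)) ≤ℚ ½ *ℚ (p ^ℚ I -ℚ p ^ℚ (I + K))
    windowBound-a′ I zero    _     = ℚ.≤-reflexive (begin-equality
      (0ℚ *ℚ q) *ℚ (1ℚ -ℚ ½ *ℚ p ^ℚ (I + 0))
        ≡⟨ solve 3 (λ a y x → (con 0ℚ :* a) :* y := con ½ :* (x :- x)) refl q (1ℚ -ℚ ½ *ℚ p ^ℚ (I + 0)) (p ^ℚ I) ⟩
      ½ *ℚ (p ^ℚ I -ℚ p ^ℚ I)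
        ≡⟨ cong (λ z → ½ *ℚ (p ^ℚ I -ℚ p ^ℚ z)) (ℕ.+-identityʳ I) ⟨
      ½ *ℚ (p ^ℚ I -ℚ p ^ℚ (I + 0)) ∎)
      where open ℚ.≤-Reasoning
    windowBound-a′ I (suc K) I+K<T = begin
      (κ *ℚ q) *ℚ (1ℚ -ℚ ½ *ℚ p ^ℚ (I + suc K))
        ≤⟨ *-monoˡ-≤-nonneg 0≤κq (≤-by-gap (½ *ℚ p ^ℚ (I + suc K)) (nonneg-* 0≤½ (^-nonneg 0≤p (I + suc K)))
             (solve 1 (λ y → con 1ℚ := (con 1ℚ :- con ½ :* y) :+ con ½ :* y) refl (p ^ℚ (I + suc K)))) ⟩
      (κ *ℚ q) *ℚ 1ℚ
        ≤⟨ *-monoˡ-≤-nonneg 0≤κq (1≤3*p^k (I + K) (ℕ.≤-trans (ℕ.≤-reflexive (sym (ℕ.+-suc I K))) I+K<T)) ⟩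
      (κ *ℚ q) *ℚ (fromℕ 3 *ℚ p ^ℚ (I + K))
        ≡⟨ cong (λ z → (κ *ℚ q) *ℚ (fromℕ 3 *ℚ z)) (^-+ p I K) ⟩
      (κ *ℚ q) *ℚ (fromℕ 3 *ℚ (X *ℚ W))
        ≡⟨ solve 4 (λ k a x w → (k :* a) :* (con (fromℕ 3) :* (x :* w)) := con ½ :* (x :* ((k :* con (fromℕ 6)) :* a :* w)))
                 refl κ q X W ⟩
      ½ *ℚ (X *ℚ ((κ *ℚ fromℕ 6) *ℚ q *ℚ W))
        ≡⟨ cong (λ z → ½ *ℚ (X *ℚ (z *ℚ q *ℚ W))) (/ℕ*fromℕ (suc K) 6 (s≤s z≤n)) ⟩
      ½ *ℚ (X *ℚ (fromℕ (suc K) *ℚ q *ℚ W))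
        ≤⟨ *-monoˡ-≤-nonneg 0≤½ (*-monoˡ-≤-nonneg (^-nonneg 0≤p I) (geometric 0≤p 0≤q K)) ⟩
      ½ *ℚ (X *ℚ (1ℚ -ℚ p ^ℚ suc K))
        ≡⟨ solve 2 (λ x v → con ½ :* (x :* (con 1ℚ :- v)) := con ½ :* (x :- x :* v)) refl X (p ^ℚ suc K) ⟩
      ½ *ℚ (X -ℚ X *ℚ p ^ℚ suc K)
        ≡⟨ cong (λ z → ½ *ℚ (X -ℚ z)) (^-+ p I (suc K)) ⟨
      ½ *ℚ (X -ℚ p ^ℚ (I + suc K)) ∎
      where
      open ℚ.≤-Reasoning
      κ : ℚ
      κ = suc K /ℕ 6
      X : ℚ
      X = p ^ℚ I
      W : ℚ
      W = p ^ℚ K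
      0≤κq : 0ℚ ≤ℚ κ *ℚ q
      0≤κq = nonneg-* (/ℕ-nonneg (suc K) 6) 0≤q

    windowBound-b′ : ∀ I K → 2 * (suc K + 1) ≤ T →
      ((T /ℕ suc K) *ℚ (q *ℚ ½)) *ℚ (½ *ℚ (p ^ℚ I -ℚ p ^ℚ (I + suc K)))
        ≤ℚ ½ *ℚ (p ^ℚ (I + K) -ℚ p ^ℚ (I + suc K))
    windowBound-b′ I K 2[K+2]≤T = begin
      (τ *ℚ (q *ℚ ½)) *ℚ (½ *ℚ (X -ℚ p ^ℚ (I + suc K)))
        ≡⟨ cong (λ z → (τ *ℚ (q *ℚ ½)) *ℚ (½ *ℚ (X -ℚ z))) (^-+ p I (suc K)) ⟩
      (τ *ℚ (q *ℚ ½)) *ℚ (½ *ℚ (X -ℚ X *ℚ p ^ℚ suc K))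
        ≡⟨ solve 4 (λ t a x v → (t :* (a :* con ½)) :* (con ½ :* (x :- x :* v))
                                 := (con ½ :* con ½) :* (t :* (a :* x)) :* (con 1ℚ :- v))
                 refl τ q X (p ^ℚ suc K) ⟩
      (½ *ℚ ½) *ℚ (τ *ℚ (q *ℚ X)) *ℚ (1ℚ -ℚ p ^ℚ suc K)
        ≤⟨ *-monoˡ-≤-nonneg (nonneg-* (nonneg-* 0≤½ 0≤½) (nonneg-* (/ℕ-nonneg T (suc K)) 0≤qX))
                            (1-p^k≤k*q 0≤p 0≤q (suc K)) ⟩
      (½ *ℚ ½) *ℚ (τ *ℚ (q *ℚ X)) *ℚ (fromℕ (suc K) *ℚ q)
        ≡⟨ solve 4 (λ t a x k → (con ½ :* con ½) :* (t :* (a :* x)) :* (k :* a)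
                                 := (con ½ :* con ½) :* (a :* (t :* k)) :* (a :* x))
                 refl τ q X (fromℕ (suc K)) ⟩
      (½ *ℚ ½) *ℚ (q *ℚ (τ *ℚ fromℕ (suc K))) *ℚ (q *ℚ X)
        ≡⟨ cong (λ z → (½ *ℚ ½) *ℚ (q *ℚ z) *ℚ (q *ℚ X)) (/ℕ*fromℕ T (suc K) (s≤s z≤n)) ⟩
      (½ *ℚ ½) *ℚ (q *ℚ fromℕ T) *ℚ (q *ℚ X)
        ≤⟨ *-monoʳ-≤-nonneg 0≤qX (*-monoˡ-≤-nonneg (nonneg-* 0≤½ 0≤½) (ℚ.≤-trans qT≤1 1≤2W)) ⟩
      (½ *ℚ ½) *ℚ (fromℕ 2 *ℚ W) *ℚ (q *ℚ X)
        ≡⟨ solve 3 (λ x w y → (con ½ :* con ½) :* (con (fromℕ 2) :* w) :* ((con 1ℚ :- y) :* x)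
                               := con ½ :* (x :* w :- x :* (y :* w)))
                 refl X W p ⟩
      ½ *ℚ (X *ℚ W -ℚ X *ℚ (p *ℚ W))
        ≡⟨ cong₂ (λ y z → ½ *ℚ (y -ℚ z)) (^-+ p I K) (^-+ p I (suc K)) ⟨
      ½ *ℚ (p ^ℚ (I + K) -ℚ p ^ℚ (I + suc K)) ∎
      where
      open ℚ.≤-Reasoning
      τ : ℚ
      τ = T /ℕ suc K
      X : ℚ
      X = p ^ℚ I
      W : ℚ
      W = p ^ℚ K
      0≤qX : 0ℚ ≤ℚ q *ℚ X
      0≤qX = nonneg-* 0≤q (^-nonneg 0≤p I)
      K+K≤T : K + K ≤ T
      K+K≤T = ℕ.≤-trans (ℕ.+-mono-≤ K≤K+2 (ℕ.≤-trans K≤K+2 (ℕ.m≤m+n (suc K + 1) 0))) 2[K+2]≤T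
        where
        K≤K+2 : K ≤ suc K + 1
        K≤K+2 = ℕ.≤-trans (ℕ.n≤1+n K) (ℕ.m≤m+n (suc K) 1)
      1≤2W : 1ℚ ≤ℚ fromℕ 2 *ℚ W
      1≤2W = begin
        1ℚ
          ≤⟨ ≤-by-gap (1ℚ -ℚ q *ℚ fromℕ (K + K)) (p≤q⇒0≤q-p (q*m≤1 K+K≤T))
               (trans (solve 2 (λ a r → con (fromℕ 2) :* (con 1ℚ :- a :* r) := con 1ℚ :+ (con 1ℚ :- r :* (a :+ a)))
                               refl (fromℕ K) q)
                      (cong (λ z → 1ℚ +ℚ (1ℚ -ℚ q *ℚ z)) (sym (fromℕ-+ K K)))) ⟩
        fromℕ 2 *ℚ (1ℚ -ℚ fromℕ K *ℚ q)
          ≤⟨ *-monoˡ-≤-nonneg (fromℕ-nonneg 2) (bernoulli 0≤p 0≤q K) ⟩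
        fromℕ 2 *ℚ W ∎

  windowBound-a : ∀ {I J} → I ≤ J → J ≤ T →
    (((J ∸ I) /ℕ 6) *ℚ q) *ℚ (1ℚ -ℚ ½ *ℚ p ^ℚ J) ≤ℚ ½ *ℚ (p ^ℚ I -ℚ p ^ℚ J)
  windowBound-a {I} {J} I≤J J≤T with J ∸ I | ℕ.m+[n∸m]≡n I≤J
  ... | K | refl = windowBound-a′ I K J≤T

  windowBound-b : ∀ {I J} → I < J → 2 * (J ∸ I + 1) ≤ T →
    ((T /ℕ (J ∸ I)) *ℚ (q *ℚ ½)) *ℚ (½ *ℚ (p ^ℚ I -ℚ p ^ℚ J)) ≤ℚ ½ *ℚ (p ^ℚ (J ∸ 1) -ℚ p ^ℚ J)
  windowBound-b {I} {J} I<J 2[K+1]≤T with J ∸ I | ℕ.m+[n∸m]≡n (ℕ.<⇒≤ I<J) | ℕ.m<n⇒0<n∸m I<J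
  ... | suc K | refl | _ =
    subst (λ z → ((T /ℕ suc K) *ℚ (q *ℚ ½)) *ℚ (½ *ℚ (p ^ℚ I -ℚ p ^ℚ (I + suc K)))
                   ≤ℚ ½ *ℚ (p ^ℚ z -ℚ p ^ℚ (I + suc K)))
          (cong (_∸ 1) (sym (ℕ.+-suc I K)))
          (windowBound-b′ I K 2[K+1]≤T)

≟-true : ∀ b → ⌊ b Bool.≟ true ⌋ ≡ b
≟-true true  = refl
≟-true false = refl

≟-false : ∀ b → ⌊ b Bool.≟ false ⌋ ≡ not b
≟-false true  = refl
≟-false false = refl

not-<ᵇ : ∀ m L → not (m <ᵇ L) ≡ (L ≤ᵇ m)
not-<ᵇ m       zero          = refl
not-<ᵇ zero    (suc L)       = refl
not-<ᵇ (suc m) (suc zero)    = refl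
not-<ᵇ (suc m) (suc (suc L)) = not-<ᵇ m (suc L)

<ᵇ-absorb : ∀ {m n} L → m ≤ n → (n <ᵇ L) ∧ (m <ᵇ L) ≡ (n <ᵇ L)
<ᵇ-absorb zero    _               = refl
<ᵇ-absorb (suc L) (z≤n {zero})  = refl
<ᵇ-absorb (suc L) (z≤n {suc n}) = Bool.∧-identityʳ (n <ᵇ L)
<ᵇ-absorb (suc L) (s≤s m≤n)       = <ᵇ-absorb L m≤n

toℕ-pred : ∀ {m} (j : Fin (suc m)) → toℕ (pred j) ≡ toℕ j ∸ 1
toℕ-pred zero    = refl
toℕ-pred (suc j) = Fin.toℕ-inject₁ j

module Conditional {T : ℕ} {p : ℚ} (1≤T : 1 ≤ T) (p≤1 : p ≤ℚ 1ℚ) (qT≤1 : (1ℚ -ℚ p) *ℚ fromℕ T ≤ℚ 1ℚ) where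
  open Bounds 1≤T p≤1 qT≤1

  module _ (i j : Fin (suc T)) (i≤j : toℕ i ≤ toℕ j) where
    private
      I J : ℕ
      I = toℕ i
      J = toℕ j
      J≤T : J ≤ T
      J≤T = Fin.toℕ≤pred[n] j

      observation : Bool → Vec Bool (suc T) → Bool
      observation b col = ⌊ lookup col j Bool.≟ b ⌋ ∧ true

      observation-absent : ∀ L → observation false (prefix (suc T) L) ≡ (L ≤ᵇ J)
      observation-absent L rewrite lookup-prefix (suc T) L j | ≟-false (J <ᵇ L) | Bool.∧-identityʳ (not (J <ᵇ L)) =
        not-<ᵇ J L

      observation-absent∧present-i : ∀ L →
        observation false (prefix (suc T) L) ∧ lookup (prefix (suc T) L) i ≡ (I <ᵇ L) ∧ (L ≤ᵇ J)
      observation-absent∧present-i L rewrite observation-absent L | lookup-prefix (suc T) L i =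
        Bool.∧-comm (L ≤ᵇ J) (I <ᵇ L)

      observation-present : ∀ L → observation true (prefix (suc T) L) ≡ (J <ᵇ L)
      observation-present L rewrite lookup-prefix (suc T) L j | ≟-true (J <ᵇ L) = Bool.∧-identityʳ (J <ᵇ L)

      observation-present∧present-i : ∀ L → observation true (prefix (suc T) L) ∧ lookup (prefix (suc T) L) i ≡ (J <ᵇ L)
      observation-present∧present-i L rewrite observation-present L | lookup-prefix (suc T) L i = <ᵇ-absorb L i≤j

    columnBound-a : (b : Bool) →
      (((toℕ j ∸ toℕ i) /ℕ 6) *ℚ q) *ℚ columnPr T p (observation b)
        ≤ℚ columnPr T p (λ col → observation b col ∧ lookup col i)
    columnBound-a false = begin
      c *ℚ columnPr T p (observation false)
        ≡⟨ cong (c *ℚ_) (trans (columnPr-via-lifetime T p (observation false) _ observation-absent)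
                               (lifetimePr-atMost T p J J≤T)) ⟩
      c *ℚ (1ℚ -ℚ ½ *ℚ p ^ℚ J)
        ≤⟨ windowBound-a i≤j J≤T ⟩
      ½ *ℚ (p ^ℚ I -ℚ p ^ℚ J)
        ≡⟨ trans (columnPr-via-lifetime T p (λ col → observation false col ∧ lookup col i) _ observation-absent∧present-i)
                 (lifetimePr-window T p I J i≤j J≤T) ⟨
      columnPr T p (λ col → observation false col ∧ lookup col i) ∎
      where
      open ℚ.≤-Reasoning
      c : ℚ
      c = ((J ∸ I) /ℕ 6) *ℚ q
    columnBound-a true = begin
      c *ℚ columnPr T p (observation true)
        ≤⟨ scale≤1 (K/6*q≤1 (J ∸ I) (ℕ.≤-trans (ℕ.m∸n≤m J I) J≤T))
                   (columnPr-nonneg 0≤p 0≤q T (observation true)) ⟩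
      columnPr T p (observation true)
        ≡⟨ columnPr-via-lifetime T p (observation true) _ observation-present ⟩
      lifetimePr T p (J <ᵇ_)
        ≡⟨ columnPr-via-lifetime T p (λ col → observation true col ∧ lookup col i) _ observation-present∧present-i ⟨
      columnPr T p (λ col → observation true col ∧ lookup col i) ∎
      where
      open ℚ.≤-Reasoning
      c : ℚ
      c = ((J ∸ I) /ℕ 6) *ℚ q

  module _ (i j : Fin (suc T)) (i<j : toℕ i < toℕ j) (2[K+1]≤T : 2 * (toℕ j ∸ toℕ i + 1) ≤ T) where
    private
      I J J′ : ℕ
      I = toℕ i
      J = toℕ j
      J′ = toℕ (pred j)
      J≤T : J ≤ T
      J≤T = Fin.toℕ≤pred[n] j
      J′≡J∸1 : J′ ≡ J ∸ 1
      J′≡J∸1 = toℕ-pred j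
      I≤J′ : I ≤ J′
      I≤J′ = subst (I ≤_) (sym J′≡J∸1) (ℕ.<⇒≤pred i<j)
      J′≤J : J′ ≤ J
      J′≤J = subst (_≤ J) (sym J′≡J∸1) (ℕ.m∸n≤m J 1)

      observation : Bool → Bool → Vec Bool (suc T) → Bool
      observation bi b col = ⌊ lookup col i Bool.≟ bi ⌋ ∧ (⌊ lookup col j Bool.≟ b ⌋ ∧ true)

      present-j′ : Vec Bool (suc T) → Bool
      present-j′ col = lookup col (pred j)

      observation-absent : ∀ L → observation true false (prefix (suc T) L) ≡ (I <ᵇ L) ∧ (L ≤ᵇ J)
      observation-absent L rewrite lookup-prefix (suc T) L i | lookup-prefix (suc T) L j
                                 | ≟-true (I <ᵇ L) | ≟-false (J <ᵇ L) | Bool.∧-identityʳ (not (J <ᵇ L)) =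
        cong ((I <ᵇ L) ∧_) (not-<ᵇ J L)

      observation-absent∧present-j′ : ∀ L →
        observation true false (prefix (suc T) L) ∧ present-j′ (prefix (suc T) L) ≡ (J′ <ᵇ L) ∧ (L ≤ᵇ J)
      observation-absent∧present-j′ L rewrite observation-absent L | lookup-prefix (suc T) L (pred j) = begin
        ((I <ᵇ L) ∧ (L ≤ᵇ J)) ∧ (J′ <ᵇ L)   ≡⟨ xy∙z≈xz∙y (I <ᵇ L) (L ≤ᵇ J) (J′ <ᵇ L) ⟩
        ((I <ᵇ L) ∧ (J′ <ᵇ L)) ∧ (L ≤ᵇ J)   ≡⟨ cong (_∧ (L ≤ᵇ J)) (Bool.∧-comm (I <ᵇ L) (J′ <ᵇ L)) ⟩
        ((J′ <ᵇ L) ∧ (I <ᵇ L)) ∧ (L ≤ᵇ J)   ≡⟨ cong (_∧ (L ≤ᵇ J)) (<ᵇ-absorb L I≤J′) ⟩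
        (J′ <ᵇ L) ∧ (L ≤ᵇ J)                 ∎
        where open ≡-Reasoning

      observation-present : ∀ L → observation true true (prefix (suc T) L) ≡ (J <ᵇ L)
      observation-present L rewrite lookup-prefix (suc T) L i | lookup-prefix (suc T) L j
                                  | ≟-true (I <ᵇ L) | ≟-true (J <ᵇ L) | Bool.∧-identityʳ (J <ᵇ L) =
        trans (Bool.∧-comm (I <ᵇ L) (J <ᵇ L)) (<ᵇ-absorb L (ℕ.<⇒≤ i<j))

      observation-present∧present-j′ : ∀ L →
        observation true true (prefix (suc T) L) ∧ present-j′ (prefix (suc T) L) ≡ (J <ᵇ L)
      observation-present∧present-j′ L rewrite observation-present L | lookup-prefix (suc T) L (pred j) =
        <ᵇ-absorb L J′≤J

    columnBound-b : (bi : Bool) → bi ≡ true → (b : Bool) →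
      ((T /ℕ (toℕ j ∸ toℕ i)) *ℚ (q *ℚ ½)) *ℚ columnPr T p (observation bi b)
        ≤ℚ columnPr T p (λ col → observation bi b col ∧ present-j′ col)
    columnBound-b .true refl false = begin
      c *ℚ columnPr T p (observation true false)
        ≡⟨ cong (c *ℚ_) (trans (columnPr-via-lifetime T p (observation true false) _ observation-absent)
                               (lifetimePr-window T p I J (ℕ.<⇒≤ i<j) J≤T)) ⟩
      c *ℚ (½ *ℚ (p ^ℚ I -ℚ p ^ℚ J))
        ≤⟨ windowBound-b i<j 2[K+1]≤T ⟩
      ½ *ℚ (p ^ℚ (J ∸ 1) -ℚ p ^ℚ J)
        ≡⟨ cong (λ z → ½ *ℚ (p ^ℚ z -ℚ p ^ℚ J)) J′≡J∸1 ⟨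
      ½ *ℚ (p ^ℚ J′ -ℚ p ^ℚ J)
        ≡⟨ trans (columnPr-via-lifetime T p (λ col → observation true false col ∧ present-j′ col) _
                                        observation-absent∧present-j′)
                 (lifetimePr-window T p J′ J J′≤J J≤T) ⟨
      columnPr T p (λ col → observation true false col ∧ present-j′ col) ∎
      where
      open ℚ.≤-Reasoning
      c : ℚ
      c = (T /ℕ (J ∸ I)) *ℚ (q *ℚ ½)
    columnBound-b .true refl true = begin
      c *ℚ columnPr T p (observation true true)
        ≤⟨ scale≤1 (T/K*q/2≤1 (J ∸ I) (ℕ.m<n⇒0<n∸m i<j)) (columnPr-nonneg 0≤p 0≤q T (observation true true)) ⟩
      columnPr T p (observation true true)
        ≡⟨ columnPr-via-lifetime T p (observation true true) _ observation-present ⟩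
      lifetimePr T p (J <ᵇ_)
        ≡⟨ columnPr-via-lifetime T p (λ col → observation true true col ∧ present-j′ col) _
                                 observation-present∧present-j′ ⟨
      columnPr T p (λ col → observation true true col ∧ present-j′ col) ∎
      where
      open ℚ.≤-Reasoning
      c : ℚ
      c = (T /ℕ (J ∸ I)) *ℚ (q *ℚ ½)

  conditional-a : ∀ {n} (i j : Fin (suc T)) → toℕ i ≤ toℕ j → (B : Subset n) (x : Fin n) →
    (((toℕ j ∸ toℕ i) /ℕ 6) *ℚ q) *ℚ Pr n T p (λ ω → ⌊ lookup ω j ≟ˢ B ⌋)
      ≤ℚ Pr n T p (λ ω → ⌊ lookup ω j ≟ˢ B ⌋ ∧ (x ∈ᵇ lookup ω i))
  conditional-a {n} i j i≤j B x = begin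
    c *ℚ Pr n T p (λ ω → ⌊ lookup ω j ≟ˢ B ⌋)
      ≡⟨ cong (c *ℚ_) (Pr-cong n T p (λ ω → sym (Bool.∧-identityʳ ⌊ lookup ω j ≟ˢ B ⌋))) ⟩
    c *ℚ Pr n T p (observed obs)
      ≤⟨ columnBound⇒bound 0≤p 0≤q c obs i x (columnBound-a i j i≤j (lookup B x)) ⟩
    Pr n T p (λ ω → observed obs ω ∧ (x ∈ᵇ lookup ω i))
      ≡⟨ Pr-cong n T p (λ ω → cong (_∧ (x ∈ᵇ lookup ω i)) (Bool.∧-identityʳ ⌊ lookup ω j ≟ˢ B ⌋)) ⟩
    Pr n T p (λ ω → ⌊ lookup ω j ≟ˢ B ⌋ ∧ (x ∈ᵇ lookup ω i)) ∎
    where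
    open ℚ.≤-Reasoning
    c : ℚ
    c = ((toℕ j ∸ toℕ i) /ℕ 6) *ℚ q
    obs : Observation n T
    obs = (j , B) ∷ []

  conditional-b : ∀ {n} (i j : Fin (suc T)) → toℕ i < toℕ j → 2 * (toℕ j ∸ toℕ i + 1) ≤ T →
    (Bi Bj : Subset n) (x : Fin n) → (x ∈ᵇ Bi) ≡ true →
    ((T /ℕ (toℕ j ∸ toℕ i)) *ℚ (q *ℚ ½)) *ℚ Pr n T p (λ ω → ⌊ lookup ω i ≟ˢ Bi ⌋ ∧ ⌊ lookup ω j ≟ˢ Bj ⌋)
      ≤ℚ Pr n T p (λ ω → ⌊ lookup ω i ≟ˢ Bi ⌋ ∧ ⌊ lookup ω j ≟ˢ Bj ⌋ ∧ (x ∈ᵇ lookup ω (pred j)))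
  conditional-b {n} i j i<j 2[K+1]≤T Bi Bj x x∈Bi = begin
    c *ℚ Pr n T p (λ ω → Ai ω ∧ Aj ω)
      ≡⟨ cong (c *ℚ_) (Pr-cong n T p (λ ω → cong (Ai ω ∧_) (sym (Bool.∧-identityʳ (Aj ω))))) ⟩
    c *ℚ Pr n T p (observed obs)
      ≤⟨ columnBound⇒bound 0≤p 0≤q c obs (pred j) x
           (columnBound-b i j i<j 2[K+1]≤T (lookup Bi x) x∈Bi (lookup Bj x)) ⟩
    Pr n T p (λ ω → observed obs ω ∧ (x ∈ᵇ lookup ω (pred j)))
      ≡⟨ Pr-cong n T p (λ ω → reassociate (Ai ω) (Aj ω) (x ∈ᵇ lookup ω (pred j))) ⟩
    Pr n T p (λ ω → Ai ω ∧ Aj ω ∧ (x ∈ᵇ lookup ω (pred j))) ∎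
    where
    open ℚ.≤-Reasoning
    c : ℚ
    c = (T /ℕ (toℕ j ∸ toℕ i)) *ℚ (q *ℚ ½)
    Ai Aj : Outcome n T → Bool
    Ai ω = ⌊ lookup ω i ≟ˢ Bi ⌋
    Aj ω = ⌊ lookup ω j ≟ˢ Bj ⌋
    obs : Observation n T
    obs = (i , Bi) ∷ (j , Bj) ∷ []
    reassociate : ∀ a b s → (a ∧ (b ∧ true)) ∧ s ≡ a ∧ b ∧ s
    reassociate a b s = trans (cong (λ z → (a ∧ z) ∧ s) (Bool.∧-identityʳ b)) (Bool.∧-assoc a b s)

[1-p]T≤1 : ∀ {T p} → 1 ≤ T → 1ℚ -ℚ (1 /ℕ T) ≤ℚ p → (1ℚ -ℚ p) *ℚ fromℕ T ≤ℚ 1ℚ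
[1-p]T≤1 {T} {p} 1≤T 1-1/T≤p = begin
  (1ℚ -ℚ p) *ℚ fromℕ T
    ≤⟨ *-monoʳ-≤-nonneg (fromℕ-nonneg T)
         (≤-by-gap {1ℚ -ℚ p} (p -ℚ (1ℚ -ℚ 1 /ℕ T)) (p≤q⇒0≤q-p 1-1/T≤p)
           (solve 2 (λ x y → y := (con 1ℚ :- x) :+ (x :- (con 1ℚ :- y))) refl p (1 /ℕ T))) ⟩
  (1 /ℕ T) *ℚ fromℕ T
    ≡⟨ /ℕ*fromℕ 1 T 1≤T ⟩
  1ℚ ∎
  where open ℚ.≤-Reasoning

lemma4p2 : (n T : ℕ) → 1 ≤ T → (p : ℚ) → (1ℚ -ℚ (1 /ℕ T)) ≤ℚ p → p <ℚ 1ℚ →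
  ((i j : Fin (suc T)) → toℕ i ≤ toℕ j → (B : Subset n) →
    0ℚ <ℚ Pr n T p (λ ω → ⌊ lookup ω j ≟ˢ B ⌋) →
    (x : Fin n) →
    (((toℕ j ∸ toℕ i) /ℕ 6) *ℚ (1ℚ -ℚ p)) *ℚ Pr n T p (λ ω → ⌊ lookup ω j ≟ˢ B ⌋)
      ≤ℚ Pr n T p (λ ω → ⌊ lookup ω j ≟ˢ B ⌋ ∧ (x ∈ᵇ lookup ω i)))
  ×
  ((i j : Fin (suc T)) → toℕ i < toℕ j → 2 * (toℕ j ∸ toℕ i + 1) ≤ T →
    (Bi Bj : Subset n) →
    0ℚ <ℚ Pr n T p (λ ω → ⌊ lookup ω i ≟ˢ Bi ⌋ ∧ ⌊ lookup ω j ≟ˢ Bj ⌋) →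
    (x : Fin n) → (x ∈ᵇ Bi) ≡ true →
    ((T /ℕ (toℕ j ∸ toℕ i)) *ℚ ((1ℚ -ℚ p) *ℚ (1 /ℕ 2)))
        *ℚ Pr n T p (λ ω → ⌊ lookup ω i ≟ˢ Bi ⌋ ∧ ⌊ lookup ω j ≟ˢ Bj ⌋)
      ≤ℚ Pr n T p (λ ω → ⌊ lookup ω i ≟ˢ Bi ⌋ ∧ ⌊ lookup ω j ≟ˢ Bj ⌋ ∧ (x ∈ᵇ lookup ω (pred j))))
lemma4p2 n T 1≤T p 1-1/T≤p p<1 =
  (λ i j i≤j B _ x → conditional-a i j i≤j B x) ,
  (λ i j i<j 2[K+1]≤T Bi Bj _ x x∈Bi → conditional-b i j i<j 2[K+1]≤T Bi Bj x x∈Bi)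
  where open Conditional 1≤T (ℚ.<⇒≤ p<1) ([1-p]T≤1 1≤T 1-1/T≤p)
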